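{- Suppose a special rim hook tableau $R$ has rim hooks $\mathfrak g_1,\dots,\mathfrak g_k$ with initial cells in rows $x_1,\dots,x_k$ and terminal cells in rows $j_1,\dots,j_k$, respectively, ordered so that $j_1<j_2<\dots<j_k$. Then $$\operatorname{perm}_{\mathrm{SRT}}(R)=(j_1,j_1-1,\dots,x_1+1,x_1)\cdots(j_k,j_k-1,\dots,x_k+1,x_k).$$
   Context: For a partition $\lambda=(\lambda_1\ge\dots\ge\lambda_\ell>0)$, its Ferrers diagram is the set of cells $(i,j)$, $1\le i\le\ell$, $1\le j\le\lambda_i$ (row $i$ from the top). A rim hook is a connected skew diagram (difference of two Ferrers diagrams of partitions) containing no $2\times2$ square. A special rim hook tableau (SRT) of shape $\lambda$ is a partition of the diagram of $\lambda$ into rim hooks each containing a cell of the first column. The initial cell of a rim hook is its northeastern-most cell; the terminal cell is its southwestern-most cell. The $d$-th diagonal is $\mathcal L_d=\{(d+k,1+k):k\in\mathbb Z\}$; each diagonal contains at most one initial cell of an SRT. $\operatorname{perm}_{\mathrm{SRT}}(R)=\sigma\in S_\ell$ is defined for $i\in[\ell]$ by: if $\mathcal L_{i-\lambda_i+1}$ contains no initial cell, $\sigma_i=i-\lambda_i$; otherwise $\sigma_i$ is the row of the terminal cell of the rim hook whose initial cell lies in $\mathcal L_{i-\lambda_i+1}$. Cycle notation: $(a_1,a_2,\dots,a_r)$ maps $a_1\mapsto a_2\mapsto\dots\mapsto a_r\mapsto a_1$ and fixes everything else (a 1-cycle is the identity); products of permutations are composed right to left, $(\sigma\tau)(i)=\sigma(\tau(i))$.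 -}

module Defs where

open import Data.Nat using (ℕ; zero; suc; _≤_; _<_; _≥_; _<ᵇ_; _≤ᵇ_; _≡ᵇ_; _∸_)
open import Data.Integer using (ℤ; +_; _-_; _+_)
import Data.Integer as ℤ
open import Data.Bool using (if_then_else_; _∧_)
open import Data.Product using (_×_; _,_; proj₁; proj₂; ∃; ∃-syntax)
open import Data.Sum using (_⊎_)
open import Data.List using (List; []; _∷_; foldr)
open import Data.List.Membership.Propositional using (_∈_; _∉_)
open import Data.List.Relation.Unary.All using (All)
open import Data.List.Relation.Unary.Any using (Any)
open import Data.List.Relation.Unary.AllPairs using (AllPairs)
open import Data.List.Relation.Unary.Linked using (Linked)
open import Data.Maybe using (Maybe; just; nothing; maybe)
open import Relation.Binary.PropositionalEquality using (_≡_)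
open import Relation.Nullary using (¬_; yes; no)
open import Function.Bundles using (_⇔_)

IsPartition : List ℕ → Set
IsPartition p = All (1 ≤_) p × Linked _≥_ p

-- rowLen p i = λ_i (1-indexed); 0 for i = 0 or i > ℓ.
rowLen : List ℕ → ℕ → ℕ
rowLen p zero = 0
rowLen [] (suc i) = 0
rowLen (a ∷ p) (suc zero) = a
rowLen (a ∷ p) (suc (suc i)) = rowLen p (suc i)

-- A cell (i , j): row i (from the top), column j.
Cell : Set
Cell = ℕ × ℕ

row : Cell → ℕ
row = proj₁

col : Cell → ℕ
col = proj₂

-- (i , j) lies in the Ferrers diagram: 1 ≤ i ≤ ℓ, 1 ≤ j ≤ λ_i
-- (the condition on i is implied since rowLen vanishes outside [1,ℓ]).
InDiagram : List ℕ → Cell → Set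
InDiagram p (i , j) = 1 ≤ i × 1 ≤ j × j ≤ rowLen p i

Hook : Set
Hook = List Cell

Adjacent : Cell → Cell → Set
Adjacent (i , j) (i' , j') =
  (i ≡ i' × (suc j ≡ j' ⊎ j ≡ suc j')) ⊎ (j ≡ j' × (suc i ≡ i' ⊎ i ≡ suc i'))

data Conn (S : Cell → Set) : Cell → Cell → Set where
  here : ∀ {a} → S a → Conn S a a
  step : ∀ {a b c} → S a → Adjacent a b → Conn S b c → Conn S a c

Connected : Hook → Set
Connected h = ∀ a b → a ∈ h → b ∈ h → Conn (_∈ h) a b

IsSkew : Hook → Set
IsSkew h = ∃[ μ ] ∃[ ν ] (IsPartition μ × IsPartition ν ×
  (∀ c → (c ∈ h) ⇔ (InDiagram ν c × ¬ InDiagram μ c)))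

No2x2 : Hook → Set
No2x2 h = ∀ i j → ¬ ((i , j) ∈ h × (suc i , j) ∈ h × (i , suc j) ∈ h × (suc i , suc j) ∈ h)

data NonEmpty {A : Set} : List A → Set where
  nonEmpty : ∀ {x xs} → NonEmpty (x ∷ xs)

IsRimHook : Hook → Set
IsRimHook h = NonEmpty h × IsSkew h × Connected h × No2x2 h

Disjoint : Hook → Hook → Set
Disjoint h h' = ∀ c → c ∈ h → c ∉ h'

IsSRT : List ℕ → List Hook → Set
IsSRT p R =
  All (λ h → IsRimHook h × Any (λ c → col c ≡ 1) h) R ×
  AllPairs Disjoint R ×
  (∀ c → InDiagram p c ⇔ Any (c ∈_) R)

-- Initial (northeastern-most) and terminal (southwestern-most) cells:
-- initial = smallest row, and in that row the largest column;
-- terminal = largest row, and in that row the smallest column.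

moreNE : Cell → Cell → Cell
moreNE a b =
  if row a <ᵇ row b then a else
  (if row b <ᵇ row a then b else (if col b <ᵇ col a then a else b))

moreSW : Cell → Cell → Cell
moreSW a b =
  if row b <ᵇ row a then a else
  (if row a <ᵇ row b then b else (if col a <ᵇ col b then a else b))

initCell : Hook → Cell
initCell [] = (0 , 0)
initCell (c ∷ cs) = foldr moreNE c cs

termCell : Hook → Cell
termCell [] = (0 , 0)
termCell (c ∷ cs) = foldr moreSW c cs

-- Diagonals: (i , j) ∈ L_d iff d = i - j + 1.

diag : Cell → ℤ
diag (i , j) = ((+ i) - (+ j)) + (+ 1)

hookOnDiag : ℤ → List Hook → Maybe Hook
hookOnDiag d [] = nothing
hookOnDiag d (h ∷ R) with diag (initCell h) ℤ.≟ d
... | yes _ = just h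
... | no _ = hookOnDiag d R

-- perm_SRT(R) as a function on rows i ∈ [ℓ] (values in ℤ, as i - λ_i
-- is a priori an integer)
permSRT : List ℕ → List Hook → ℕ → ℤ
permSRT p R i =
  maybe (λ h → + row (termCell h)) ((+ i) - (+ rowLen p i))
        (hookOnDiag (((+ i) - (+ rowLen p i)) + (+ 1)) R)

-- cyc x j  (x ≤ j) is the cycle (j, j-1, …, x+1, x):
-- a ↦ a - 1 for x < a ≤ j, x ↦ j, everything else fixed.
cyc : ℕ → ℕ → ℕ → ℕ
cyc x j a =
  if a ≡ᵇ x then j else (if (x <ᵇ a) ∧ (a ≤ᵇ j) then a ∸ 1 else a)

-- product c₁ c₂ ⋯ c_k composed right to left
cycProd : List (ℕ × ℕ) → ℕ → ℕ
cycProd [] a = a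
cycProd ((x , j) ∷ cs) a = cyc x j (cycProd cs a)

module Submission where

-- Induct on the number of rim hooks, removing the hook g whose terminal cell (ℓ , 1) is lowest;
-- it contributes the last cycle σ = (ℓ, ℓ−1, …, x). Disjoint rim hooks do not cross: a hook
-- lying below g on one diagonal stays below g on every later diagonal both meet. As all other
-- terminal cells lie in column 1 above row ℓ, g runs along the outer rim from the row end
-- (x , λ_x) down to (ℓ , 1). Removing g shifts each row i ∈ (x, ℓ] up by one and shortens it by
-- one cell, so its row end stays on the same diagonal, now as the row end of row σ(i) = i − 1;
-- the other rows i ≠ x keep their row ends. Row x is sent to ℓ by g itself, which is the only
-- hook starting on that diagonal because every initial cell lies on the diagonal of a row end.
-- Hence perm(R) = perm(R ∖ g) ∘ σ.

open import Defs
open import Data.Nat using (ℕ; zero; suc; pred; _+_; _∸_; _≤_; _<_; _≥_; z≤n; s≤s; _≤′_; ≤′-refl; ≤′-step)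
open import Data.Nat using (_<ᵇ_; _≤ᵇ_; _≡ᵇ_)
open import Data.Nat.Properties
open import Data.Nat.Tactic.RingSolver using (solve-∀)
open import Data.Integer using (ℤ; +_)
import Data.Integer as ℤ
import Data.Integer.Properties as ℤ
open import Data.Integer.Tactic.RingSolver renaming (solve-∀ to ℤ-solve-∀)
open import Algebra.Properties.AbelianGroup ℤ.+-0-abelianGroup as ℤ+ using ()
open import Data.Bool using (true; false)
open import Data.Empty using (⊥)
open import Data.Product using (_,_; ∃-syntax; _×_; proj₁; proj₂)
open import Data.Sum using (_⊎_; inj₁; inj₂; [_,_]′)
open import Data.Maybe using (just; nothing; maybe; _<∣>_)
open import Data.Maybe.Properties using (<∣>-identityʳ)
open import Data.List using (List; []; _∷_; _++_; _∷ʳ_; map; length; foldr)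
open import Data.List.Properties using (map-++)
open import Data.List.Reverse using (Reverse; []; _∶_∶ʳ_; reverseView)
open import Data.List.Membership.Propositional using (_∈_; _∉_; find; lose)
open import Data.List.Relation.Unary.Any using (Any; here; there)
open import Data.List.Relation.Unary.Any.Properties using (++⁺ˡ; ++⁺ʳ; ++⁻)
open import Data.List.Relation.Unary.All as All using (All; []; _∷_)
open import Data.List.Relation.Unary.All.Properties using (∷ʳ⁻; ∷ʳ⁺; map⁻)
open import Data.List.Relation.Unary.AllPairs using (AllPairs; []; _∷_)
open import Data.List.Relation.Unary.Linked as Linked using (Linked)
open import Data.List.Relation.Unary.Linked.Properties using (Linked⇒AllPairs)
open import Function.Base using (_∘_; case_of_)
open import Function.Bundles using (Equivalence; _⇔_; mk⇔)
open import Relation.Binary.Definitions using (tri<; tri≈; tri>)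
open import Relation.Binary.PropositionalEquality using (_≡_; _≢_; refl; sym; trans; cong; subst)
open import Relation.Binary.PropositionalEquality using (module ≡-Reasoning)
open import Relation.Nullary using (¬_; contradiction; yes; no)
open import Relation.Nullary.Reflects as Reflects using (Reflects; ofʸ; ofⁿ)

+-swap-outer : ∀ x y z w → (x + y) + (z + w) ≡ (x + w) + (z + y)
+-swap-outer = solve-∀

≤-cross-trans : ∀ {a b c d e f} → a + d ≤ c + b → c + f ≤ e + d → a + f ≤ e + b
≤-cross-trans {a} {b} {c} {d} {e} {f} p q = +-cancelʳ-≤ (c + d) (a + f) (e + b) (begin
  (a + f) + (c + d) ≡⟨ +-swap-outer a d c f ⟨
  (a + d) + (c + f) ≤⟨ +-mono-≤ p q ⟩
  (c + b) + (e + d) ≡⟨ +-swap-outer c b e d ⟩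
  (c + d) + (e + b) ≡⟨ +-comm (c + d) (e + b) ⟩
  (e + b) + (c + d) ∎)
  where open ≤-Reasoning

≤pred⇒< : ∀ {m n} → 1 ≤ m → m ≤ pred n → m < n
≤pred⇒< {n = suc n} _ m≤n = s≤s m≤n
≤pred⇒< {n = zero} 1≤m m≤0 = contradiction (≤-trans 1≤m m≤0) λ ()

_≼_ : Cell → Cell → Set
a ≼ b = row a ≤ row b × col a ≤ col b

-- Diagonals are ordered by the content row − col, compared here without subtraction.
_≤ᵈ_ : Cell → Cell → Set
a ≤ᵈ b = row a + col b ≤ row b + col a

_≈ᵈ_ : Cell → Cell → Set
a ≈ᵈ b = row a + col b ≡ row b + col a

≤ᵈ-trans : ∀ {a} b {c} → a ≤ᵈ b → b ≤ᵈ c → a ≤ᵈ c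
≤ᵈ-trans {a} b {c} = ≤-cross-trans {row a} {col a} {row b} {col b} {row c} {col c}

≈ᵈ⇒≤ᵈ : ∀ {a b} → a ≈ᵈ b → a ≤ᵈ b
≈ᵈ⇒≤ᵈ = ≤-reflexive

≈ᵈ-trans : ∀ {a} b {c} → a ≈ᵈ b → b ≈ᵈ c → a ≈ᵈ c
≈ᵈ-trans {a} b {c} p q =
  ≤-antisym (≤ᵈ-trans {a} b {c} (≤-reflexive p) (≤-reflexive q))
            (≤ᵈ-trans {c} b {a} (≤-reflexive (sym q)) (≤-reflexive (sym p)))

≈ᵈ∧row≡⇒≡ : ∀ {a b} → a ≈ᵈ b → row a ≡ row b → a ≡ b
≈ᵈ∧row≡⇒≡ {a} e refl = cong (row a ,_) (sym (+-cancelˡ-≡ (row a) _ _ e))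

≈ᵈ∧row<⇒col< : ∀ {a b} → a ≈ᵈ b → row a < row b → col a < col b
≈ᵈ∧row<⇒col< e ra<rb = ≰⇒> λ cb≤ca → <-irrefl e (+-mono-<-≤ ra<rb cb≤ca)

≈ᵈ∧col≤⇒row≤ : ∀ {a b} → a ≈ᵈ b → col a ≤ col b → row a ≤ row b
≈ᵈ∧col≤⇒row≤ e ca≤cb = ≮⇒≥ λ rb<ra → <-irrefl (sym e) (+-mono-<-≤ rb<ra ca≤cb)

-- Shapes are given by row-length functions, InDiagram p being InShape (rowLen p), so that
-- removing a rim hook again yields a shape of the same kind.
InShape : (ℕ → ℕ) → Cell → Set
InShape L (i , j) = 1 ≤ i × 1 ≤ j × j ≤ L i

RowsDecreasing : (ℕ → ℕ) → Set
RowsDecreasing L = ∀ {a b} → 1 ≤ a → a ≤ b → L b ≤ L a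

inShape-≼ : ∀ {L} → RowsDecreasing L → ∀ {a b} → InShape L b → 1 ≤ row a → 1 ≤ col a → a ≼ b →
            InShape L a
inShape-≼ decr (_ , _ , cb≤L) 1≤ra 1≤ca (ra≤rb , ca≤cb) =
  1≤ra , 1≤ca , ≤-trans ca≤cb (≤-trans cb≤L (decr 1≤ra ra≤rb))

rowsDecreasing-by-steps : ∀ {L} → (∀ i → L (suc (suc i)) ≤ L (suc i)) → RowsDecreasing L
rowsDecreasing-by-steps {L} shrinks {suc a} _ a≤b = go (≤⇒≤′ a≤b)
  where
    go : ∀ {b} → suc a ≤′ b → L b ≤ L (suc a)
    go ≤′-refl = ≤-refl
    go (≤′-step {suc b} p) = ≤-trans (shrinks b) (go p)
    go (≤′-step {zero} p) = contradiction (≤′⇒≤ p) λ ()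

rowLen-step : ∀ {p} → Linked _≥_ p → ∀ i → rowLen p (suc (suc i)) ≤ rowLen p (suc i)
rowLen-step {[]} _ i = z≤n
rowLen-step {a ∷ []} _ _ = z≤n
rowLen-step {a ∷ b ∷ p} (a≥b Linked.∷ _) zero = a≥b
rowLen-step {a ∷ b ∷ p} (_ Linked.∷ bp) (suc i) = rowLen-step bp i

rowLen-decreasing : ∀ {p} → IsPartition p → RowsDecreasing (rowLen p)
rowLen-decreasing (_ , linked) = rowsDecreasing-by-steps (rowLen-step linked)

skew-positive : ∀ {h} → IsSkew h → ∀ {c} → c ∈ h → 1 ≤ row c × 1 ≤ col c
skew-positive (_ , _ , _ , _ , iff) {c} c∈h =
  let (1≤r , 1≤c , _) , _ = Equivalence.to (iff c) c∈h in 1≤r , 1≤c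

skew-convex : ∀ {h} → IsSkew h → ∀ {a c} b → a ∈ h → c ∈ h → a ≼ b → b ≼ c → b ∈ h
skew-convex (μ , ν , μ-partition , ν-partition , iff) {a} {c} b a∈h c∈h a≼b b≼c
  with Equivalence.to (iff a) a∈h | Equivalence.to (iff c) c∈h
... | (1≤ra , 1≤ca , _) , a∉μ | c∈ν , _ = Equivalence.from (iff b) (b∈ν , b∉μ)
  where
    b∈ν : InDiagram ν b
    b∈ν = inShape-≼ (rowLen-decreasing ν-partition) c∈ν
            (≤-trans 1≤ra (proj₁ a≼b)) (≤-trans 1≤ca (proj₂ a≼b)) b≼c
    b∉μ : ¬ InDiagram μ b
    b∉μ b∈μ = a∉μ (inShape-≼ (rowLen-decreasing μ-partition) b∈μ 1≤ra 1≤ca a≼b)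

rimHook-diagonal-row≮ : ∀ {h} → IsSkew h → No2x2 h → ∀ {a b} → a ∈ h → b ∈ h → a ≈ᵈ b →
                        ¬ row a < row b
rimHook-diagonal-row≮ {h} skew no2x2 {a} {b} a∈h b∈h a≈b ra<rb =
  no2x2 (row a) (col a) (a∈h , inside (suc (row a) , col a) (n≤1+n _ , ≤-refl) (≤-refl , n≤1+n _) ,
                              inside (row a , suc (col a)) (≤-refl , n≤1+n _) (n≤1+n _ , ≤-refl) ,
                              inside (suc (row a) , suc (col a)) (n≤1+n _ , n≤1+n _) (≤-refl , ≤-refl))
  where
    ca<cb : col a < col b
    ca<cb = ≈ᵈ∧row<⇒col< {a} {b} a≈b ra<rb
    inside : ∀ d → a ≼ d → d ≼ (suc (row a) , suc (col a)) → d ∈ h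
    inside d a≼d (rd≤ , cd≤) = skew-convex skew d a∈h b∈h a≼d (≤-trans rd≤ ra<rb , ≤-trans cd≤ ca<cb)

rimHook-diagonal-unique : ∀ {h} → IsSkew h → No2x2 h → ∀ {a b} → a ∈ h → b ∈ h → a ≈ᵈ b → a ≡ b
rimHook-diagonal-unique skew no2x2 {a} {b} a∈h b∈h a≈b = ≈ᵈ∧row≡⇒≡ {a} {b} a≈b (≤-antisym
  (≮⇒≥ (rimHook-diagonal-row≮ skew no2x2 b∈h a∈h (sym a≈b)))
  (≮⇒≥ (rimHook-diagonal-row≮ skew no2x2 a∈h b∈h a≈b)))

-- Reading rows top to bottom and each row from right to left, a ⊑ b says a is read no
-- later than b; initCell and termCell select the ⊑-least and ⊑-greatest cell.
_⊑_ : Cell → Cell → Set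
a ⊑ b = row a < row b ⊎ (row a ≡ row b × col b ≤ col a)

⊑-refl : ∀ {a} → a ⊑ a
⊑-refl = inj₂ (refl , ≤-refl)

⊑-trans : ∀ {a b c} → a ⊑ b → b ⊑ c → a ⊑ c
⊑-trans (inj₁ ra<rb) (inj₁ rb<rc) = inj₁ (<-trans ra<rb rb<rc)
⊑-trans (inj₁ ra<rb) (inj₂ (refl , _)) = inj₁ ra<rb
⊑-trans (inj₂ (refl , _)) (inj₁ rb<rc) = inj₁ rb<rc
⊑-trans (inj₂ (refl , cb≤ca)) (inj₂ (refl , cc≤cb)) = inj₂ (refl , ≤-trans cc≤cb cb≤ca)

⊑⇒row≤ : ∀ {a b} → a ⊑ b → row a ≤ row b
⊑⇒row≤ (inj₁ ra<rb) = <⇒≤ ra<rb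
⊑⇒row≤ (inj₂ (ra≡rb , _)) = ≤-reflexive ra≡rb

moreNE-select : ∀ a b → (moreNE a b ≡ a × a ⊑ b) ⊎ (moreNE a b ≡ b × b ⊑ a)
moreNE-select a b with row a <ᵇ row b | <ᵇ-reflects-< (row a) (row b)
... | true | ofʸ ra<rb = inj₁ (refl , inj₁ ra<rb)
... | false | ofⁿ ra≮rb with row b <ᵇ row a | <ᵇ-reflects-< (row b) (row a)
...   | true | ofʸ rb<ra = inj₂ (refl , inj₁ rb<ra)
...   | false | ofⁿ rb≮ra with col b <ᵇ col a | <ᵇ-reflects-< (col b) (col a)
...     | true | ofʸ cb<ca = inj₁ (refl , inj₂ (≤-antisym (≮⇒≥ rb≮ra) (≮⇒≥ ra≮rb) , <⇒≤ cb<ca))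
...     | false | ofⁿ cb≮ca = inj₂ (refl , inj₂ (≤-antisym (≮⇒≥ ra≮rb) (≮⇒≥ rb≮ra) , ≮⇒≥ cb≮ca))

moreSW-select : ∀ a b → (moreSW a b ≡ a × b ⊑ a) ⊎ (moreSW a b ≡ b × a ⊑ b)
moreSW-select a b with row b <ᵇ row a | <ᵇ-reflects-< (row b) (row a)
... | true | ofʸ rb<ra = inj₁ (refl , inj₁ rb<ra)
... | false | ofⁿ rb≮ra with row a <ᵇ row b | <ᵇ-reflects-< (row a) (row b)
...   | true | ofʸ ra<rb = inj₂ (refl , inj₁ ra<rb)
...   | false | ofⁿ ra≮rb with col a <ᵇ col b | <ᵇ-reflects-< (col a) (col b)
...     | true | ofʸ ca<cb = inj₁ (refl , inj₂ (≤-antisym (≮⇒≥ ra≮rb) (≮⇒≥ rb≮ra) , <⇒≤ ca<cb))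
...     | false | ofⁿ ca≮cb = inj₂ (refl , inj₂ (≤-antisym (≮⇒≥ rb≮ra) (≮⇒≥ ra≮rb) , ≮⇒≥ ca≮cb))

module _ {A : Set} {_≲_ : A → A → Set}
         (≲-refl : ∀ {a} → a ≲ a) (≲-trans : ∀ {a b c} → a ≲ b → b ≲ c → a ≲ c)
         (op : A → A → A) (op-select : ∀ a b → (op a b ≡ a × a ≲ b) ⊎ (op a b ≡ b × b ≲ a)) where

  foldr-selects-least : ∀ c cs → foldr op c cs ∈ c ∷ cs × All (foldr op c cs ≲_) (c ∷ cs)
  foldr-selects-least c [] = here refl , ≲-refl ∷ []
  foldr-selects-least c (d ∷ ds) with foldr op c ds | foldr-selects-least c ds | op-select d (foldr op c ds)
  ... | m | _ , m≲c ∷ m≲ds | inj₁ (op≡d , d≲m) rewrite op≡d =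
    there (here refl) , ≲-trans d≲m m≲c ∷ ≲-refl ∷ All.map (≲-trans d≲m) m≲ds
  ... | m | m∈ , m≲c ∷ m≲ds | inj₂ (op≡m , m≲d) rewrite op≡m = skip-second m∈ , m≲c ∷ m≲d ∷ m≲ds
    where
      skip-second : m ∈ c ∷ ds → m ∈ c ∷ d ∷ ds
      skip-second (here m≡c) = here m≡c
      skip-second (there m∈ds) = there (there m∈ds)

initCell-least : ∀ {h} → NonEmpty h → initCell h ∈ h × All (initCell h ⊑_) h
initCell-least {c ∷ cs} nonEmpty = foldr-selects-least ⊑-refl ⊑-trans moreNE moreNE-select c cs

termCell-greatest : ∀ {h} → NonEmpty h → termCell h ∈ h × All (_⊑ termCell h) h
termCell-greatest {c ∷ cs} nonEmpty =
  foldr-selects-least {_≲_ = λ a b → b ⊑ a} ⊑-refl (λ p q → ⊑-trans q p) moreSW moreSW-select c cs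

_<ᵈ_ : Cell → Cell → Set
a <ᵈ b = row a + col b < row b + col a

adjacent-<ᵈ⇒≤ᵈ : ∀ {a b} z → Adjacent a b → a <ᵈ z → b ≤ᵈ z
adjacent-<ᵈ⇒≤ᵈ {r , c} z (inj₁ (refl , inj₁ refl)) a<z = ≤-trans (<⇒≤ a<z) (+-monoʳ-≤ (row z) (n≤1+n c))
adjacent-<ᵈ⇒≤ᵈ {r , _} {_ , c} z (inj₁ (refl , inj₂ refl)) a<z =
  ≤-pred (subst (suc (r + col z) ≤_) (+-suc (row z) c) a<z)
adjacent-<ᵈ⇒≤ᵈ z (inj₂ (refl , inj₁ refl)) a<z = a<z
adjacent-<ᵈ⇒≤ᵈ z (inj₂ (refl , inj₂ refl)) a<z = ≤-trans (n≤1+n _) (<⇒≤ a<z)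

path-meets-diagonals : ∀ {S a b} → Conn S a b → ∀ z → a ≤ᵈ z → z ≤ᵈ b → ∃[ c ] S c × c ≈ᵈ z
path-meets-diagonals {a = a} (here Sa) z a≤z z≤b = a , Sa , ≤-antisym a≤z z≤b
path-meets-diagonals {a = a} (step Sa adj rest) z a≤z z≤b with m≤n⇒m<n∨m≡n a≤z
... | inj₂ a≈z = a , Sa , a≈z
... | inj₁ a<z = path-meets-diagonals rest z (adjacent-<ᵈ⇒≤ᵈ z adj a<z) z≤b

below left southeast : Cell → Cell
below c = suc (row c) , col c
left c = row c , pred (col c)
southeast c = suc (row c) , suc (col c)

left≈ᵈbelow : ∀ {c} → 1 ≤ col c → left c ≈ᵈ below c
left≈ᵈbelow {r , suc k} _ = +-suc r k

≈ᵈ-southeast : ∀ c → c ≈ᵈ southeast c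
≈ᵈ-southeast c = +-suc (row c) (col c)

SpecialRimHook : Hook → Set
SpecialRimHook h = IsRimHook h × Any (λ c → col c ≡ 1) h

module RimHook {h : Hook} (special : SpecialRimHook h) where

  private
    nonempty : NonEmpty h
    nonempty = proj₁ (proj₁ special)
    skew : IsSkew h
    skew = proj₁ (proj₂ (proj₁ special))
    connected : Connected h
    connected = proj₁ (proj₂ (proj₂ (proj₁ special)))
    no2x2 : No2x2 h
    no2x2 = proj₂ (proj₂ (proj₂ (proj₁ special)))

  ι τ : Cell
  ι = initCell h
  τ = termCell h

  ι∈h : ι ∈ h
  ι∈h = proj₁ (initCell-least nonempty)

  τ∈h : τ ∈ h
  τ∈h = proj₁ (termCell-greatest nonempty)

  ι⊑ : ∀ {e} → e ∈ h → ι ⊑ e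
  ι⊑ = All.lookup (proj₂ (initCell-least nonempty))

  ⊑τ : ∀ {e} → e ∈ h → e ⊑ τ
  ⊑τ = All.lookup (proj₂ (termCell-greatest nonempty))

  row≤τ : ∀ {e} → e ∈ h → row e ≤ row τ
  row≤τ e∈h = ⊑⇒row≤ (⊑τ e∈h)

  positive : ∀ {c} → c ∈ h → 1 ≤ row c × 1 ≤ col c
  positive = skew-positive skew

  convex : ∀ {a c} b → a ∈ h → c ∈ h → a ≼ b → b ≼ c → b ∈ h
  convex = skew-convex skew

  diagonal-unique : ∀ {a b} → a ∈ h → b ∈ h → a ≈ᵈ b → a ≡ b
  diagonal-unique = rimHook-diagonal-unique skew no2x2

  τ-col≡1 : col τ ≡ 1
  τ-col≡1 with find (proj₂ special)
  ... | z , z∈h , col-z≡1 =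
    ≤-antisym (col≤1 (⊑τ (convex (row τ , 1) z∈h τ∈h z≼ ≼τ))) (proj₂ (positive τ∈h))
    where
      z≼ : z ≼ (row τ , 1)
      z≼ = row≤τ z∈h , ≤-reflexive col-z≡1
      ≼τ : (row τ , 1) ≼ τ
      ≼τ = ≤-refl , proj₂ (positive τ∈h)
      col≤1 : (row τ , 1) ⊑ τ → col τ ≤ 1
      col≤1 (inj₁ rτ<rτ) = contradiction rτ<rτ (<-irrefl refl)
      col≤1 (inj₂ (_ , cτ≤1)) = cτ≤1

  -- A cell of h on an earlier diagonal than ι, but not above it, forces (row ι , 1 + col ι) into h.
  ι≤ᵈ : ∀ {e} → e ∈ h → ι ≤ᵈ e
  ι≤ᵈ {e} e∈h = ≮⇒≥ λ e<ι → ι-not-rightmost (≰⇒> λ ce≤cι → <⇒≱ e<ι (+-mono-≤ rι≤re ce≤cι))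
    where
      rι≤re : row ι ≤ row e
      rι≤re = ⊑⇒row≤ (ι⊑ e∈h)
      ι-not-rightmost : col ι < col e → ⊥
      ι-not-rightmost cι<ce
        with ι⊑ (convex (row ι , suc (col ι)) ι∈h e∈h (≤-refl , n≤1+n _) (rι≤re , cι<ce))
      ... | inj₁ rι<rι = <-irrefl refl rι<rι
      ... | inj₂ (_ , 1+cι≤cι) = 1+n≰n 1+cι≤cι

  ≤ᵈτ : ∀ {e} → e ∈ h → e ≤ᵈ τ
  ≤ᵈτ {e} e∈h = subst (λ k → row e + k ≤ row τ + col e) (sym τ-col≡1)
                  (+-mono-≤ (row≤τ e∈h) (proj₂ (positive e∈h)))

  meets-diagonals : ∀ z → ι ≤ᵈ z → z ≤ᵈ τ → ∃[ c ] c ∈ h × c ≈ᵈ z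
  meets-diagonals = path-meets-diagonals (connected ι τ ι∈h τ∈h)

  next-diagonal-rows : ∀ {c c'} → c ∈ h → c' ∈ h → c' ≈ᵈ below c → row c ≤ row c' × row c' ≤ suc (row c)
  next-diagonal-rows {c} {c'} c∈h c'∈h c'≈below = ≮⇒≥ not-above , ≮⇒≥ not-far-below
    where
      not-above : ¬ row c' < row c
      not-above rc'<rc = <-irrefl (sym (cong row (diagonal-unique left∈h c'∈h left≈c'))) rc'<rc
        where
          left≈c' : left c ≈ᵈ c'
          left≈c' = ≈ᵈ-trans (below c) (left≈ᵈbelow (proj₂ (positive c∈h))) (sym c'≈below)
          left∈h : left c ∈ h
          left∈h = convex (left c) c'∈h c∈h
                     (<⇒≤ rc'<rc , <⇒≤ (≈ᵈ∧row<⇒col< {c'} {left c} (sym left≈c') rc'<rc))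
                     (≤-refl , pred[n]≤n)
      not-far-below : ¬ suc (row c) < row c'
      not-far-below below<rc' = <-irrefl (cong row (diagonal-unique below∈h c'∈h (sym c'≈below))) below<rc'
        where
          below∈h : below c ∈ h
          below∈h = convex (below c) c∈h c'∈h (n≤1+n _ , ≤-refl)
                      (<⇒≤ below<rc' , <⇒≤ (≈ᵈ∧row<⇒col< {below c} {c'} (sym c'≈below) below<rc'))

  next-diagonal-cell : ∀ {c c'} → c ∈ h → c' ∈ h → c' ≈ᵈ below c → c' ≡ below c ⊎ c' ≡ left c
  next-diagonal-cell {c} {c'} c∈h c'∈h c'≈below = by-rows (next-diagonal-rows c∈h c'∈h c'≈below)
    where
      by-rows : row c ≤ row c' × row c' ≤ suc (row c) → c' ≡ below c ⊎ c' ≡ left c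
      by-rows (rc≤rc' , rc'≤1+rc) with m≤n⇒m<n∨m≡n rc'≤1+rc
      ... | inj₂ rc'≡1+rc = inj₁ (≈ᵈ∧row≡⇒≡ {c'} {below c} c'≈below rc'≡1+rc)
      ... | inj₁ rc'<1+rc = inj₂ (≈ᵈ∧row≡⇒≡ {c'} {left c}
              (≈ᵈ-trans (below c) c'≈below (sym (left≈ᵈbelow (proj₂ (positive c∈h)))))
              (≤-antisym (≤-pred rc'<1+rc) rc≤rc'))

-- Disjoint rim hooks do not cross

down : ℕ → Cell → Cell
down k c = k + row c , col c

down-≈ᵈ-step : ∀ k {u u₁} → u₁ ≈ᵈ below u → down (suc k) u ≈ᵈ down k u₁
down-≈ᵈ-step k {u} {u₁} u₁≈ = begin
  (suc k + row u) + col u₁  ≡⟨ cong (_+ col u₁) (sym (+-suc k (row u))) ⟩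
  (k + suc (row u)) + col u₁ ≡⟨ +-assoc k _ _ ⟩
  k + (suc (row u) + col u₁) ≡⟨ cong (λ n → k + n) (sym u₁≈) ⟩
  k + (row u₁ + col u)      ≡⟨ +-assoc k _ _ ⟨
  (k + row u₁) + col u      ∎
  where open ≡-Reasoning

≤ᵈ⇒≈ᵈ-down : ∀ {u u'} → u ≤ᵈ u' → u' ≈ᵈ down (row u' + col u ∸ (row u + col u')) u
≤ᵈ⇒≈ᵈ-down {u} {u'} u≤u' =
  trans (sym (m∸n+n≡m u≤u')) (sym (+-assoc (row u' + col u ∸ (row u + col u')) (row u) (col u')))

module _ {g h : Hook} (special-g : SpecialRimHook g) (special-h : SpecialRimHook h) (h∩g=∅ : Disjoint h g) where

  private
    module G = RimHook special-g
    module H = RimHook special-h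

  below-on-next-diagonal : ∀ {u v u₁ v₁} → u ∈ h → v ∈ g → u ≈ᵈ v → row v < row u →
                           u₁ ∈ h → v₁ ∈ g → u₁ ≈ᵈ below u → v₁ ≈ᵈ below u → row v₁ < row u₁
  below-on-next-diagonal {u} {v} {u₁} {v₁} u∈h v∈g u≈v rv<ru u₁∈h v₁∈g u₁≈ v₁≈ =
    ≤∧≢⇒< (≤-trans rv₁≤1+rv (≤-trans rv<ru ru≤ru₁)) λ rv₁≡ru₁ →
      h∩g=∅ u₁ u₁∈h
        (subst (_∈ g) (≈ᵈ∧row≡⇒≡ {v₁} {u₁} (≈ᵈ-trans (below u) v₁≈ (sym u₁≈)) rv₁≡ru₁) v₁∈g)
    where
      ru≤ru₁ : row u ≤ row u₁
      ru≤ru₁ = proj₁ (H.next-diagonal-rows u∈h u₁∈h u₁≈)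
      rv₁≤1+rv : row v₁ ≤ suc (row v)
      rv₁≤1+rv = proj₂ (G.next-diagonal-rows v∈g v₁∈g (≈ᵈ-trans (below u) v₁≈ (cong suc u≈v)))

  -- Induction on the number k of diagonals from u to u'; both hooks meet every diagonal in between.
  below-on-later-diagonals : ∀ k {u v u' v'} → u ∈ h → v ∈ g → u ≈ᵈ v → row v < row u →
                             u' ∈ h → v' ∈ g → u' ≈ᵈ v' → u' ≈ᵈ down k u → row v' < row u'
  below-on-later-diagonals zero {u} {v} u∈h v∈g u≈v rv<ru u'∈h v'∈g u'≈v' u'≈u
    rewrite H.diagonal-unique u'∈h u∈h u'≈u
          | G.diagonal-unique v'∈g v∈g (≈ᵈ-trans u (sym u'≈v') u≈v) = rv<ru
  below-on-later-diagonals (suc k) {u} {v} {u'} {v'} u∈h v∈g u≈v rv<ru u'∈h v'∈g u'≈v' u'≈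
    with H.meets-diagonals (below u) (≤ᵈ-trans u (H.ι≤ᵈ u∈h) u≤below)
                                     (≤ᵈ-trans u' below≤u' (H.≤ᵈτ u'∈h))
       | G.meets-diagonals (below u)
           (≤ᵈ-trans v (G.ι≤ᵈ v∈g) (≤ᵈ-trans u (≈ᵈ⇒≤ᵈ {v} {u} (sym u≈v)) u≤below))
           (≤ᵈ-trans u' below≤u' (≤ᵈ-trans v' (≈ᵈ⇒≤ᵈ {u'} {v'} u'≈v') (G.≤ᵈτ v'∈g)))
    where
      u≤below : u ≤ᵈ below u
      u≤below = n≤1+n _
      below≤u' : below u ≤ᵈ u'
      below≤u' = ≤ᵈ-trans (down (suc k) u) (+-monoˡ-≤ (col u) (s≤s (m≤n+m (row u) k)))
                   (≈ᵈ⇒≤ᵈ {down (suc k) u} {u'} (sym u'≈))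
  ... | u₁ , u₁∈h , u₁≈ | v₁ , v₁∈g , v₁≈ =
    below-on-later-diagonals k u₁∈h v₁∈g (≈ᵈ-trans (below u) u₁≈ (sym v₁≈))
      (below-on-next-diagonal u∈h v∈g u≈v rv<ru u₁∈h v₁∈g u₁≈ v₁≈)
      u'∈h v'∈g u'≈v' (≈ᵈ-trans (down (suc k) u) u'≈ (down-≈ᵈ-step k u₁≈))

  stays-below : ∀ {u v u' v'} → u ∈ h → v ∈ g → u ≈ᵈ v → row v < row u →
                u' ∈ h → v' ∈ g → u' ≈ᵈ v' → u ≤ᵈ u' → row v' < row u'
  stays-below {u} {u' = u'} u∈h v∈g u≈v rv<ru u'∈h v'∈g u'≈v' u≤u' =
    below-on-later-diagonals _ u∈h v∈g u≈v rv<ru u'∈h v'∈g u'≈v' (≤ᵈ⇒≈ᵈ-down {u} {u'} u≤u')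

-- perm_SRT and cycles

diag-difference : ∀ (A B C D : ℤ) →
                  ((A ℤ.- B) ℤ.+ + 1) ℤ.- ((C ℤ.- D) ℤ.+ + 1) ≡ (A ℤ.+ D) ℤ.- (C ℤ.+ B)
diag-difference = ℤ-solve-∀

diag≡⇒≈ᵈ : ∀ a b → diag a ≡ diag b → a ≈ᵈ b
diag≡⇒≈ᵈ (ra , ca) (rb , cb) e = ℤ.+-injective (ℤ.i-j≡0⇒i≡j _ _
  (trans (sym (diag-difference (+ ra) (+ ca) (+ rb) (+ cb))) (ℤ.i≡j⇒i-j≡0 e)))

≈ᵈ⇒diag≡ : ∀ a b → a ≈ᵈ b → diag a ≡ diag b
≈ᵈ⇒diag≡ (ra , ca) (rb , cb) e = ℤ.i-j≡0⇒i≡j _ _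
  (trans (diag-difference (+ ra) (+ ca) (+ rb) (+ cb)) (ℤ.i≡j⇒i-j≡0 (cong +_ e)))

hookOnDiag-++ : ∀ d xs ys → hookOnDiag d (xs ++ ys) ≡ hookOnDiag d xs <∣> hookOnDiag d ys
hookOnDiag-++ d [] ys = refl
hookOnDiag-++ d (x ∷ xs) ys with diag (initCell x) ℤ.≟ d
... | yes _ = refl
... | no _ = hookOnDiag-++ d xs ys

StartsOnDiagonalOf : Cell → Hook → Set
StartsOnDiagonalOf c h = initCell h ≈ᵈ c

hookOnDiag-none : ∀ c xs → All (¬_ ∘ StartsOnDiagonalOf c) xs → hookOnDiag (diag c) xs ≡ nothing
hookOnDiag-none c [] [] = refl
hookOnDiag-none c (x ∷ xs) (elsewhere ∷ rest) with diag (initCell x) ℤ.≟ diag c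
... | yes on = contradiction (diag≡⇒≈ᵈ (initCell x) c on) elsewhere
... | no _ = hookOnDiag-none c xs rest

hookOnDiag-here : ∀ c {x xs} → StartsOnDiagonalOf c x → hookOnDiag (diag c) (x ∷ xs) ≡ just x
hookOnDiag-here c {x} on with diag (initCell x) ℤ.≟ diag c
... | yes _ = refl
... | no elsewhere = contradiction (≈ᵈ⇒diag≡ (initCell x) c on) elsewhere

termRow initRow : Hook → ℕ
termRow h = row (termCell h)
initRow h = row (initCell h)

-- permSRT p is permS (rowLen p) by definition.
permS : (ℕ → ℕ) → List Hook → ℕ → ℤ
permS L R i = maybe (λ h → + termRow h) (+ i ℤ.- + L i) (hookOnDiag (diag (i , L i)) R)

permS-∷ʳ-other : ∀ {L R g i} → ¬ StartsOnDiagonalOf (i , L i) g → permS L (R ∷ʳ g) i ≡ permS L R i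
permS-∷ʳ-other {L} {R} {g} {i} g-elsewhere = cong (maybe (λ h → + termRow h) (+ i ℤ.- + L i)) (begin
  hookOnDiag d (R ++ g ∷ [])               ≡⟨ hookOnDiag-++ d R (g ∷ []) ⟩
  hookOnDiag d R <∣> hookOnDiag d (g ∷ []) ≡⟨ cong (hookOnDiag d R <∣>_) g-absent ⟩
  hookOnDiag d R <∣> nothing               ≡⟨ <∣>-identityʳ _ ⟩
  hookOnDiag d R                           ∎)
  where
    open ≡-Reasoning
    d : ℤ
    d = diag (i , L i)
    g-absent : hookOnDiag d (g ∷ []) ≡ nothing
    g-absent = hookOnDiag-none (i , L i) (g ∷ []) (g-elsewhere ∷ [])

permS-∷ʳ-own : ∀ {L R g i} → StartsOnDiagonalOf (i , L i) g → All (¬_ ∘ StartsOnDiagonalOf (i , L i)) R →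
               permS L (R ∷ʳ g) i ≡ + termRow g
permS-∷ʳ-own {L} {R} {g} {i} g-here R-elsewhere = cong (maybe (λ h → + termRow h) (+ i ℤ.- + L i)) (begin
  hookOnDiag d (R ++ g ∷ [])               ≡⟨ hookOnDiag-++ d R (g ∷ []) ⟩
  hookOnDiag d R <∣> hookOnDiag d (g ∷ []) ≡⟨ cong (_<∣> hookOnDiag d (g ∷ [])) (hookOnDiag-none _ R R-elsewhere) ⟩
  hookOnDiag d (g ∷ [])                    ≡⟨ hookOnDiag-here (i , L i) g-here ⟩
  just g                                   ∎)
  where
    open ≡-Reasoning
    d : ℤ
    d = diag (i , L i)

permS-fixed : ∀ {L R i} → L i ≡ 0 → All (¬_ ∘ StartsOnDiagonalOf (i , 0)) R → permS L R i ≡ + i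
permS-fixed {L} {R} {i} Li≡0 R-elsewhere rewrite Li≡0 =
  trans (cong (maybe (λ h → + termRow h) (+ i ℤ.- + 0)) (hookOnDiag-none (i , 0) R R-elsewhere))
        (ℤ.+-identityʳ (+ i))

permS-cong : ∀ {L L' R i k} → (i , L i) ≈ᵈ (k , L' k) → permS L R i ≡ permS L' R k
permS-cong {L} {L'} {R} {i} {k} e = cong (λ E → maybe (λ h → + termRow h) E (hookOnDiag (E ℤ.+ + 1) R))
  (ℤ+.∙-cancelʳ (+ 1) _ _ (≈ᵈ⇒diag≡ (i , L i) (k , L' k) e))

≡ᵇ-reflects-≡ : ∀ m n → Reflects (m ≡ n) (m ≡ᵇ n)
≡ᵇ-reflects-≡ m n = Reflects.fromEquivalence (≡ᵇ⇒≡ m n) (≡⇒≡ᵇ m n)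

cyc-at : ∀ x j → cyc x j x ≡ j
cyc-at x j with x ≡ᵇ x | ≡ᵇ-reflects-≡ x x
... | true | _ = refl
... | false | ofⁿ x≢x = contradiction refl x≢x

cyc-below : ∀ {x j a} → a < x → cyc x j a ≡ a
cyc-below {x} {j} {a} a<x with a ≡ᵇ x | ≡ᵇ-reflects-≡ a x | x <ᵇ a | <ᵇ-reflects-< x a
... | true | ofʸ a≡x | _ | _ = contradiction a≡x (<⇒≢ a<x)
... | false | _ | true | ofʸ x<a = contradiction x<a (<⇒≯ a<x)
... | false | _ | false | _ = refl

cyc-within : ∀ {x j a} → x < a → a ≤ j → cyc x j a ≡ a ∸ 1
cyc-within {x} {j} {a} x<a a≤j
  with a ≡ᵇ x | ≡ᵇ-reflects-≡ a x | x <ᵇ a | <ᵇ-reflects-< x a | a ≤ᵇ j | ≤ᵇ-reflects-≤ a j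
... | true | ofʸ a≡x | _ | _ | _ | _ = contradiction (sym a≡x) (<⇒≢ x<a)
... | false | _ | false | ofⁿ x≮a | _ | _ = contradiction x<a x≮a
... | false | _ | true | _ | false | ofⁿ a≰j = contradiction a≤j a≰j
... | false | _ | true | _ | true | _ = refl

cyc-above : ∀ {x j a} → x < a → j < a → cyc x j a ≡ a
cyc-above {x} {j} {a} x<a j<a
  with a ≡ᵇ x | ≡ᵇ-reflects-≡ a x | x <ᵇ a | a ≤ᵇ j | ≤ᵇ-reflects-≤ a j
... | true | ofʸ a≡x | _ | _ | _ = contradiction (sym a≡x) (<⇒≢ x<a)
... | false | _ | false | _ | _ = refl
... | false | _ | true | true | ofʸ a≤j = contradiction a≤j (<⇒≱ j<a)
... | false | _ | true | false | _ = refl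

cyc-positive : ∀ {x j a} → 1 ≤ x → x ≤ j → 1 ≤ a → 1 ≤ cyc x j a
cyc-positive {x} {j} {a} 1≤x x≤j 1≤a with <-cmp a x
... | tri< a<x _ _ = subst (1 ≤_) (sym (cyc-below a<x)) 1≤a
... | tri≈ _ refl _ = subst (1 ≤_) (sym (cyc-at x j)) (≤-trans 1≤x x≤j)
... | tri> _ _ x<a with a ≤? j
...   | yes a≤j = subst (1 ≤_) (sym (cyc-within x<a a≤j)) (≤-trans 1≤x (pred-mono-≤ x<a))
...   | no a≰j = subst (1 ≤_) (sym (cyc-above x<a (≰⇒> a≰j))) 1≤a

cycProd-∷ʳ : ∀ cs x j a → cycProd (cs ∷ʳ (x , j)) a ≡ cycProd cs (cyc x j a)
cycProd-∷ʳ [] x j a = refl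
cycProd-∷ʳ ((y , k) ∷ cs) x j a = cong (cyc y k) (cycProd-∷ʳ cs x j a)

-- Removing the rim hook with the lowest terminal cell

-- The row lengths left after removing an outer rim hook that starts in row x and ends in
-- column 1: rows from x on lose their last cell and move up by one.
stripRim : ℕ → (ℕ → ℕ) → ℕ → ℕ
stripRim x L r with r <? x
... | yes _ = L r
... | no _ = pred (L (suc r))

stripRim-< : ∀ {x L r} → r < x → stripRim x L r ≡ L r
stripRim-< {x} {L} {r} r<x with r <? x
... | yes _ = refl
... | no r≮x = contradiction r<x r≮x

stripRim-≥ : ∀ {x L r} → x ≤ r → stripRim x L r ≡ pred (L (suc r))
stripRim-≥ {x} {L} {r} x≤r with r <? x
... | yes r<x = contradiction x≤r (<⇒≱ r<x)
... | no _ = refl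

stripRim-decreasing : ∀ {x L} → RowsDecreasing L → RowsDecreasing (stripRim x L)
stripRim-decreasing {x} {L} decr {a} {b} 1≤a a≤b with a <? x | b <? x
... | yes _ | yes _ = decr 1≤a a≤b
... | yes _ | no _ = ≤-trans pred[n]≤n (decr 1≤a (≤-trans a≤b (n≤1+n b)))
... | no a≮x | yes b<x = contradiction (≤-<-trans a≤b b<x) a≮x
... | no _ | no _ = pred-mono-≤ (decr (s≤s z≤n) (s≤s a≤b))

stripRim-⊆ : ∀ {x L} → RowsDecreasing L → ∀ {c} → InShape (stripRim x L) c → InShape L c
stripRim-⊆ {x} {L} decr {r , s} (1≤r , 1≤s , s≤) with r <? x
... | yes _ = 1≤r , 1≤s , s≤
... | no _ = 1≤r , 1≤s , ≤-trans s≤ (≤-trans pred[n]≤n (decr 1≤r (n≤1+n r)))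

stripRim-rowEnd-above : ∀ {x L r} → r < x → (r , L r) ≈ᵈ (r , stripRim x L r)
stripRim-rowEnd-above {x} {L} {r} r<x = cong (λ n → r + n) (stripRim-< {x} {L} r<x)

stripRim-rowEnd-moves-up : ∀ {x L i} → x < i → 1 ≤ L i → (i , L i) ≈ᵈ (i ∸ 1 , stripRim x L (i ∸ 1))
stripRim-rowEnd-moves-up {x} {L} {suc i} (s≤s x≤i) 1≤L rewrite stripRim-≥ {x} {L} x≤i =
  sym (left≈ᵈbelow {i , L (suc i)} 1≤L)

stripRim-rowEnd-empty : ∀ {x L i} → x ≤ i → L i ≡ 0 → L (suc i) ≡ 0 → (i , L i) ≈ᵈ (i , stripRim x L i)
stripRim-rowEnd-empty {x} {L} {i} x≤i Li≡0 L1+i≡0 rewrite stripRim-≥ {x} {L} x≤i | Li≡0 | L1+i≡0 = refl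

InitOnRowEndDiagonal : (ℕ → ℕ) → Hook → Set
InitOnRowEndDiagonal L h = ∃[ r ] 1 ≤ r × 1 ≤ L r × StartsOnDiagonalOf (r , L r) h

stripRim-rowEndDiagonal : ∀ {x L h} → InitOnRowEndDiagonal (stripRim x L) h → InitOnRowEndDiagonal L h
stripRim-rowEndDiagonal {x} {L} {h} (r , 1≤r , 1≤L'r , ι≈) with r <? x
... | yes _ = r , 1≤r , 1≤L'r , ι≈
... | no _ = suc r , s≤s z≤n , 1≤L ,
             ≈ᵈ-trans (r , pred (L (suc r))) ι≈ (left≈ᵈbelow {r , L (suc r)} 1≤L)
  where
    1≤L : 1 ≤ L (suc r)
    1≤L = ≤-trans 1≤L'r pred[n]≤n

rowEnds-distinct : ∀ {L a b} → RowsDecreasing L → 1 ≤ a → 1 ≤ b → a ≢ b → ¬ (a , L a) ≈ᵈ (b , L b)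
rowEnds-distinct {L} {a} {b} decr 1≤a 1≤b a≢b e with <-cmp a b
... | tri< a<b _ _ = <-irrefl e (+-mono-<-≤ a<b (decr 1≤a (<⇒≤ a<b)))
... | tri≈ _ a≡b _ = a≢b a≡b
... | tri> _ _ b<a = <-irrefl (sym e) (+-mono-<-≤ b<a (decr 1≤b (<⇒≤ b<a)))

stripRim-rowEnds-avoid : ∀ {x L r} → RowsDecreasing L → 1 ≤ x → 1 ≤ r → 1 ≤ stripRim x L r →
                         ¬ (r , stripRim x L r) ≈ᵈ (x , L x)
stripRim-rowEnds-avoid {x} {L} {r} decr 1≤x 1≤r 1≤L'r e with r <? x
... | yes r<x = rowEnds-distinct decr 1≤r 1≤x (<⇒≢ r<x) e
... | no r≮x = rowEnds-distinct decr (s≤s z≤n) 1≤x (<⇒≢ (s≤s (≮⇒≥ r≮x)) ∘ sym)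
                 (≈ᵈ-trans (r , pred (L (suc r)))
                   (sym (left≈ᵈbelow {r , L (suc r)} (≤-trans 1≤L'r pred[n]≤n))) e)

AllPairs-∷ʳ⁻ : ∀ {A : Set} {P : A → A → Set} xs {y} →
               AllPairs P (xs ∷ʳ y) → AllPairs P xs × All (λ x → P x y) xs
AllPairs-∷ʳ⁻ [] _ = [] , []
AllPairs-∷ʳ⁻ (x ∷ xs) (x-rel ∷ rest) with ∷ʳ⁻ x-rel | AllPairs-∷ʳ⁻ xs rest
... | x-rel-xs , x-rel-y | rest-xs , rest-y = x-rel-xs ∷ rest-xs , x-rel-y ∷ rest-y

record SortedSRT (L : ℕ → ℕ) (R : List Hook) : Set where
  field
    decreasing : RowsDecreasing L
    special    : All SpecialRimHook R
    disjoint   : AllPairs Disjoint R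
    covers     : ∀ c → InShape L c ⇔ Any (c ∈_) R
    sorted     : AllPairs _<_ (map termRow R)

module LastHook {L : ℕ → ℕ} {R : List Hook} {g : Hook} (T : SortedSRT L (R ∷ʳ g)) where

  open SortedSRT T

  special-R : All SpecialRimHook R
  special-R = proj₁ (∷ʳ⁻ special)

  special-g : SpecialRimHook g
  special-g = proj₂ (∷ʳ⁻ special)

  module G = RimHook special-g
  module Other {h} (h∈R : h ∈ R) = RimHook (All.lookup special-R h∈R)

  x ℓ : ℕ
  x = initRow g
  ℓ = termRow g

  L' : ℕ → ℕ
  L' = stripRim x L

  disjoint-from-g : ∀ {h} → h ∈ R → Disjoint h g
  disjoint-from-g = All.lookup (proj₂ (AllPairs-∷ʳ⁻ R disjoint))

  sorted-R : AllPairs _<_ (map termRow R) × All (_< ℓ) (map termRow R)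
  sorted-R = AllPairs-∷ʳ⁻ (map termRow R) (subst (AllPairs _<_) (map-++ termRow R (g ∷ [])) sorted)

  termRow<ℓ : ∀ {h} → h ∈ R → termRow h < ℓ
  termRow<ℓ = All.lookup (map⁻ (proj₂ sorted-R))

  in-shape : ∀ {h c} → h ∈ R → c ∈ h → InShape L c
  in-shape h∈R c∈h = Equivalence.from (covers _) (++⁺ˡ (lose h∈R c∈h))

  g-in-shape : ∀ {c} → c ∈ g → InShape L c
  g-in-shape c∈g = Equivalence.from (covers _) (++⁺ʳ R (here c∈g))

  hook-of : ∀ {c} → InShape L c → (∃[ h ] h ∈ R × c ∈ h) ⊎ c ∈ g
  hook-of c∈L with ++⁻ R (Equivalence.to (covers _) c∈L)
  ... | inj₁ in-R = inj₁ (find in-R)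
  ... | inj₂ (here c∈g) = inj₂ c∈g

  1≤x : 1 ≤ x
  1≤x = proj₁ (G.positive G.ι∈h)

  x≤ℓ : x ≤ ℓ
  x≤ℓ = G.row≤τ G.ι∈h

  1≤Lℓ : 1 ≤ L ℓ
  1≤Lℓ = subst (_≤ L ℓ) G.τ-col≡1 (proj₂ (proj₂ (g-in-shape G.τ∈h)))

  row≤ℓ : ∀ {c} → InShape L c → row c ≤ ℓ
  row≤ℓ c∈L with hook-of c∈L
  ... | inj₁ (h , h∈R , c∈h) = ≤-trans (Other.row≤τ h∈R c∈h) (<⇒≤ (termRow<ℓ h∈R))
  ... | inj₂ c∈g = G.row≤τ c∈g

  rows-after-ℓ-empty : ∀ {r} → ℓ < r → L r ≡ 0
  rows-after-ℓ-empty {r} ℓ<r =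
    n<1⇒n≡0 (≰⇒> λ 1≤Lr → <⇒≱ ℓ<r (row≤ℓ {r , 1} (≤-trans (s≤s z≤n) ℓ<r , ≤-refl , 1≤Lr)))

  τ≤ᵈτ-g : ∀ {h} → h ∈ R → termCell h ≤ᵈ G.τ
  τ≤ᵈτ-g {h} h∈R rewrite Other.τ-col≡1 h∈R | G.τ-col≡1 =
    +-monoˡ-≤ 1 (<⇒≤ (termRow<ℓ h∈R))

  -- A cell of another hook h southeast of a cell of g would put h below g on that diagonal,
  -- hence still below g on the diagonal of h's terminal cell, which lies in column 1.
  g-outer : ∀ {c} → c ∈ g → ¬ InShape L (southeast c)
  g-outer {c} c∈g se∈L with hook-of se∈L
  ... | inj₂ se∈g = <-irrefl (cong row (G.diagonal-unique c∈g se∈g (≈ᵈ-southeast c))) (n<1+n (row c))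
  ... | inj₁ (h , h∈R , se∈h) with G.meets-diagonals (termCell h) ι≤τ (τ≤ᵈτ-g h∈R)
    where
      ι≤τ : G.ι ≤ᵈ termCell h
      ι≤τ = ≤ᵈ-trans c (G.ι≤ᵈ c∈g)
              (≤ᵈ-trans (southeast c) (≤-reflexive (≈ᵈ-southeast c)) (Other.≤ᵈτ h∈R se∈h))
  ...   | v , v∈g , v≈τ = <⇒≱ g-above-τ (≈ᵈ∧col≤⇒row≤ {termCell h} {v} (sym v≈τ) τ-col≤)
    where
      τ-col≤ : col (termCell h) ≤ col v
      τ-col≤ = subst (_≤ col v) (sym (Other.τ-col≡1 h∈R)) (proj₂ (G.positive v∈g))
      g-above-τ : row v < termRow h
      g-above-τ = stays-below special-g (All.lookup special-R h∈R) (disjoint-from-g h∈R)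
                    se∈h c∈g (sym (≈ᵈ-southeast c)) (n<1+n (row c))
                    (Other.τ∈h h∈R) v∈g (sym v≈τ) (Other.≤ᵈτ h∈R se∈h)

  -- The cell right of ι would belong to another hook h, whose cell on the next diagonal
  -- would be southeast of ι or ι itself.
  ι-rowEnd : col G.ι ≡ L x
  ι-rowEnd = ≤-antisym (proj₂ (proj₂ (g-in-shape G.ι∈h)))
                       (≮⇒≥ λ cι<Lx → right-of-ι-outside (1≤x , s≤s z≤n , cι<Lx))
    where
      w : Cell
      w = x , suc (col G.ι)
      not-in-g : w ∉ g
      not-in-g w∈g with G.ι⊑ w∈g
      ... | inj₁ x<x = <-irrefl refl x<x
      ... | inj₂ (_ , 1+cι≤cι) = 1+n≰n 1+cι≤cι
      not-in-R : ∀ {h} → h ∈ R → w ∉ h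
      not-in-R {h} h∈R w∈h
        with Other.meets-diagonals h∈R (below w) (≤ᵈ-trans w (Other.ι≤ᵈ h∈R w∈h) (n≤1+n _)) w<τ
        where
          w<τ : below w ≤ᵈ termCell h
          w<τ = ≤∧≢⇒< (Other.≤ᵈτ h∈R w∈h) λ w≈τ → <-irrefl
                  (sym (trans (cong col (Other.diagonal-unique h∈R w∈h (Other.τ∈h h∈R) w≈τ))
                              (Other.τ-col≡1 h∈R)))
                  (s≤s (proj₂ (G.positive G.ι∈h)))
      ... | u , u∈h , u≈ =
        [ (λ u≡se-ι → g-outer G.ι∈h (subst (InShape L) u≡se-ι (in-shape h∈R u∈h)))
        , (λ u≡ι → disjoint-from-g h∈R G.ι (subst (_∈ h) u≡ι u∈h) G.ι∈h)
        ]′ (Other.next-diagonal-cell h∈R w∈h u∈h u≈)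
      right-of-ι-outside : ¬ InShape L w
      right-of-ι-outside w∈L with hook-of w∈L
      ... | inj₁ (h , h∈R , w∈h) = not-in-R h∈R w∈h
      ... | inj₂ w∈g = not-in-g w∈g

  -- The cell of g on the diagonal of c is neither above c (by g-outer) nor below it.
  outer-from-x-in-g : ∀ {c} → InShape L c → x ≤ row c → ¬ InShape L (southeast c) → c ∈ g
  outer-from-x-in-g {r , s} c∈L@(1≤r , 1≤s , s≤Lr) x≤r se∉L with G.meets-diagonals (r , s) ι≤c c≤τ
    where
      ι≤c : G.ι ≤ᵈ (r , s)
      ι≤c = subst (λ k → x + s ≤ r + k) (sym ι-rowEnd) (+-mono-≤ x≤r (≤-trans s≤Lr (decreasing 1≤x x≤r)))
      c≤τ : (r , s) ≤ᵈ G.τ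
      c≤τ = subst (λ k → r + k ≤ ℓ + s) (sym G.τ-col≡1) (+-mono-≤ (row≤ℓ c∈L) 1≤s)
  ... | v , v∈g , v≈c with <-cmp (row v) r
  ...   | tri≈ _ rv≡r _ = subst (_∈ g) (≈ᵈ∧row≡⇒≡ {v} {r , s} v≈c rv≡r) v∈g
  ...   | tri< rv<r _ _ = contradiction
      (inShape-≼ decreasing c∈L (s≤s z≤n) (s≤s z≤n) (rv<r , ≈ᵈ∧row<⇒col< {v} {r , s} v≈c rv<r))
      (g-outer v∈g)
  ...   | tri> _ _ r<rv = contradiction
      (inShape-≼ decreasing (g-in-shape v∈g) (s≤s z≤n) (s≤s z≤n) (r<rv , ≈ᵈ∧row<⇒col< {r , s} {v} (sym v≈c) r<rv))
      se∉L

  stripped-avoids-g : ∀ {c} → InShape L' c → c ∉ g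
  stripped-avoids-g {r , s} (_ , 1≤s , s≤L'r) c∈g with r <? x
  ... | yes r<x = <⇒≱ r<x (⊑⇒row≤ (G.ι⊑ c∈g))
  ... | no _ = g-outer c∈g (s≤s z≤n , s≤s z≤n , ≤pred⇒< 1≤s s≤L'r)

  remaining-in-stripped : ∀ {h c} → h ∈ R → c ∈ h → InShape L' c
  remaining-in-stripped {h} {r , s} h∈R c∈h with r <? x
  ... | yes _ = in-shape h∈R c∈h
  ... | no r≮x with suc s ≤? L (suc r)
  ...   | yes s<L = proj₁ (in-shape h∈R c∈h) , proj₁ (proj₂ (in-shape h∈R c∈h)) , <⇒≤pred s<L
  ...   | no s≮L = contradiction (outer-from-x-in-g (in-shape h∈R c∈h) (≮⇒≥ r≮x) (s≮L ∘ proj₂ ∘ proj₂))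
                                   (disjoint-from-g h∈R (r , s) c∈h)

  without-g : SortedSRT L' R
  without-g = record
    { decreasing = stripRim-decreasing {x} decreasing
    ; special    = special-R
    ; disjoint   = proj₁ (AllPairs-∷ʳ⁻ R disjoint)
    ; covers     = λ c → mk⇔ (from-stripped {c}) to-stripped
    ; sorted     = proj₁ sorted-R
    }
    where
      from-stripped : ∀ {c} → InShape L' c → Any (c ∈_) R
      from-stripped c∈L' with hook-of (stripRim-⊆ {x} decreasing c∈L')
      ... | inj₁ (h , h∈R , c∈h) = lose h∈R c∈h
      ... | inj₂ c∈g = contradiction c∈g (stripped-avoids-g c∈L')
      to-stripped : ∀ {c} → Any (c ∈_) R → InShape L' c
      to-stripped in-R = let (h , h∈R , c∈h) = find in-R in remaining-in-stripped h∈R c∈h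

  ι≈rowEnd : StartsOnDiagonalOf (x , L x) g
  ι≈rowEnd = cong (λ n → x + n) (sym ι-rowEnd)

  g-on-rowEnd-diagonal : InitOnRowEndDiagonal L g
  g-on-rowEnd-diagonal = x , 1≤x , subst (1 ≤_) ι-rowEnd (proj₂ (G.positive G.ι∈h)) , ι≈rowEnd

  g-not-on-rowEnd : ∀ {i} → 1 ≤ i → i ≢ x → ¬ StartsOnDiagonalOf (i , L i) g
  g-not-on-rowEnd {i} 1≤i i≢x ι≈ =
    rowEnds-distinct decreasing 1≤x 1≤i (i≢x ∘ sym) (≈ᵈ-trans G.ι (sym ι≈rowEnd) ι≈)

  R-avoids-rowEnd-x : All (InitOnRowEndDiagonal L') R → All (¬_ ∘ StartsOnDiagonalOf (x , L x)) R
  R-avoids-rowEnd-x = All.map λ {h} → avoids h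
    where
      avoids : ∀ h → InitOnRowEndDiagonal L' h → ¬ StartsOnDiagonalOf (x , L x) h
      avoids h (r , 1≤r , 1≤L'r , ι≈) ι≈x =
        stripRim-rowEnds-avoid decreasing 1≤x 1≤r 1≤L'r (≈ᵈ-trans (initCell h) (sym ι≈) ι≈x)

  R-avoids-ℓ : All (¬_ ∘ StartsOnDiagonalOf (ℓ , 0)) R
  R-avoids-ℓ = All.tabulate λ {h} h∈R ι≈ → <⇒≱ (termRow<ℓ h∈R) (ℓ≤termRow h∈R ι≈)
    where
      ℓ≤termRow : ∀ {h} → h ∈ R → StartsOnDiagonalOf (ℓ , 0) h → ℓ ≤ termRow h
      ℓ≤termRow {h} h∈R ι≈ =
        ≤-trans (m≤m+n ℓ (col (termCell h))) (≤-trans ℓ≤τ (≤-reflexive (+-identityʳ (termRow h))))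
        where
          ℓ≤τ : (ℓ , 0) ≤ᵈ termCell h
          ℓ≤τ = ≤ᵈ-trans (initCell h) (≈ᵈ⇒≤ᵈ {ℓ , 0} {initCell h} (sym ι≈)) (Other.ι≤ᵈ h∈R (Other.τ∈h h∈R))

  L'ℓ≡0 : L' ℓ ≡ 0
  L'ℓ≡0 = trans (stripRim-≥ {x} {L} x≤ℓ) (cong pred (rows-after-ℓ-empty (n<1+n ℓ)))

  rowEnd-follows-cycle : ∀ {i} → 1 ≤ i → i ≢ x → (i , L i) ≈ᵈ (cyc x ℓ i , L' (cyc x ℓ i))
  rowEnd-follows-cycle {i} 1≤i i≢x with <-cmp i x
  ... | tri< i<x _ _ rewrite cyc-below {x} {ℓ} i<x = stripRim-rowEnd-above {x} {L} i<x
  ... | tri≈ _ i≡x _ = contradiction i≡x i≢x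
  ... | tri> _ _ x<i with i ≤? ℓ
  ...   | yes i≤ℓ rewrite cyc-within {x} {ℓ} x<i i≤ℓ =
          stripRim-rowEnd-moves-up {x} {L} x<i (≤-trans 1≤Lℓ (decreasing 1≤i i≤ℓ))
  ...   | no i≰ℓ rewrite cyc-above {x} {ℓ} x<i (≰⇒> i≰ℓ) =
          stripRim-rowEnd-empty {x} {L} (<⇒≤ x<i) (rows-after-ℓ-empty ℓ<i) (rows-after-ℓ-empty (m≤n⇒m≤1+n ℓ<i))
    where
      ℓ<i : ℓ < i
      ℓ<i = ≰⇒> i≰ℓ

  permS-without-g : All (InitOnRowEndDiagonal L') R →
                    ∀ i → 1 ≤ i → permS L (R ∷ʳ g) i ≡ permS L' R (cyc x ℓ i)
  permS-without-g R-ends i 1≤i with i ≟ x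
  ... | yes refl = begin
    permS L (R ∷ʳ g) x     ≡⟨ permS-∷ʳ-own {L} {R} {g} ι≈rowEnd (R-avoids-rowEnd-x R-ends) ⟩
    + ℓ                    ≡⟨ permS-fixed {L'} {R} L'ℓ≡0 R-avoids-ℓ ⟨
    permS L' R ℓ           ≡⟨ cong (permS L' R) (cyc-at x ℓ) ⟨
    permS L' R (cyc x ℓ x) ∎
    where open ≡-Reasoning
  ... | no i≢x = begin
    permS L (R ∷ʳ g) i     ≡⟨ permS-∷ʳ-other {L} {R} {g} (g-not-on-rowEnd 1≤i i≢x) ⟩
    permS L R i            ≡⟨ permS-cong {L} {L'} {R} (rowEnd-follows-cycle 1≤i i≢x) ⟩
    permS L' R (cyc x ℓ i) ∎
    where open ≡-Reasoning

rowPair : Hook → ℕ × ℕ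
rowPair h = initRow h , termRow h

empty-shape : ∀ {L} → SortedSRT L [] → ∀ {i} → 1 ≤ i → L i ≡ 0
empty-shape T {i} 1≤i =
  n<1⇒n≡0 (≰⇒> λ 1≤Li → case Equivalence.to (SortedSRT.covers T (i , 1)) (1≤i , ≤-refl , 1≤Li) of λ ())

initCells-on-rowEnd-diagonals : ∀ {R} → Reverse R → ∀ {L} → SortedSRT L R → All (InitOnRowEndDiagonal L) R
initCells-on-rowEnd-diagonals [] T = []
initCells-on-rowEnd-diagonals (R ∶ rs ∶ʳ g) {L} T =
  ∷ʳ⁺ (All.map (λ {h} → stripRim-rowEndDiagonal {x} {L} {h}) (initCells-on-rowEnd-diagonals rs without-g))
      g-on-rowEnd-diagonal
  where open LastHook T

permS-cycProd : ∀ {R} → Reverse R → ∀ {L} → SortedSRT L R →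
                ∀ i → 1 ≤ i → permS L R i ≡ + cycProd (map rowPair R) i
permS-cycProd [] {L} T i 1≤i = permS-fixed {L} (empty-shape T 1≤i) []
permS-cycProd (R ∶ rs ∶ʳ g) {L} T i 1≤i = begin
  permS L (R ∷ʳ g) i                      ≡⟨ permS-without-g (initCells-on-rowEnd-diagonals rs without-g) i 1≤i ⟩
  permS L' R (cyc x ℓ i)                  ≡⟨ permS-cycProd rs without-g (cyc x ℓ i) (cyc-positive 1≤x x≤ℓ 1≤i) ⟩
  + cycProd (map rowPair R) (cyc x ℓ i)   ≡⟨ cong +_ (cycProd-∷ʳ (map rowPair R) x ℓ i) ⟨
  + cycProd (map rowPair R ∷ʳ (x , ℓ)) i  ≡⟨ cong (λ cs → + cycProd cs i) (map-++ rowPair R (g ∷ [])) ⟨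
  + cycProd (map rowPair (R ∷ʳ g)) i      ∎
  where
    open LastHook T
    open ≡-Reasoning

IsSRT⇒SortedSRT : ∀ {p R} → IsPartition p → IsSRT p R → Linked _<_ (map termRow R) →
                  SortedSRT (rowLen p) R
IsSRT⇒SortedSRT partition (special , disjoint , covers) sorted = record
  { decreasing = rowLen-decreasing partition
  ; special    = special
  ; disjoint   = disjoint
  ; covers     = covers
  ; sorted     = Linked⇒AllPairs <-trans sorted
  }

-- The formula holds for every row i ≥ 1.
proposition6p5 : (p : List ℕ) (R : List Hook) → IsPartition p → IsSRT p R →
    Linked _<_ (map (λ h → row (termCell h)) R) →
    (i : ℕ) → 1 ≤ i → i ≤ length p →
    permSRT p R i ≡ + cycProd (map (λ h → row (initCell h) , row (termCell h)) R) i
proposition6p5 p R partition srt sorted i 1≤i _ =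
  permS-cycProd (reverseView R) (IsSRT⇒SortedSRT partition srt sorted) i 1≤i
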